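{- Let $T$ be a tree of order $n$, and let $v_iv_j\in E(T)$ be any edge, where $d_i\geq d_j$ are the degrees of $v_i,v_j$. If $(d_i,d_j)\neq(n-1,1)$, then $$\frac{d_i\,d_j}{d_i^2+d_j^2}\geq \frac{n-2}{(n-2)^2+1}>\frac{n-1}{(n-1)^2+1}.$$
   Context: $d_i$ denotes the degree of vertex $v_i$ in $T$. -}

module Defs where

open import Data.Nat using (ℕ; zero; suc; _+_)
open import Data.Bool using (Bool; true; false; if_then_else_)
open import Data.Fin using (Fin; zero; suc; inject₁; fromℕ)
open import Data.List using (List; map; allFin)
open import Data.Nat.ListAction using (sum)
open import Data.Integer using (+_)
open import Data.Rational using (ℚ; _/_; 0ℚ)
open import Data.Product using (Σ; _×_)
open import Function.Definitions using (Injective)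
open import Relation.Binary.PropositionalEquality using (_≡_)
open import Relation.Nullary using (¬_)

record Graph (n : ℕ) : Set where
  field
    adj       : Fin n → Fin n → Bool
    symmetric : ∀ u v → adj u v ≡ adj v u
    loopless  : ∀ v → adj v v ≡ false

open Graph public

Adj : ∀ {n} → Graph n → Fin n → Fin n → Set
Adj G u v = adj G u v ≡ true

degree : ∀ {n} → Graph n → Fin n → ℕ
degree {n} G v = sum (map (λ u → if adj G v u then 1 else 0) (allFin n))

data Walk {n} (G : Graph n) : Fin n → Fin n → Set where
  [] : ∀ {u} → Walk G u u
  _∷_ : ∀ {u v w} → Adj G u v → Walk G v w → Walk G u w

Connected : ∀ {n} → Graph n → Set
Connected G = ∀ u v → Walk G u v

-- a cycle of length k+3: distinct vertices c 0, …, c (k+2), consecutive ones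
-- adjacent and c (k+2) adjacent to c 0
record Cycle {n} (G : Graph n) : Set where
  field
    k        : ℕ
    c        : Fin (suc (suc (suc k))) → Fin n
    distinct : Injective _≡_ _≡_ c
    step     : ∀ (i : Fin (suc (suc k))) → Adj G (c (inject₁ i)) (c (suc i))
    close    : Adj G (c (fromℕ (suc (suc k)))) (c zero)

Acyclic : ∀ {n} → Graph n → Set
Acyclic G = ¬ Cycle G

IsTree : ∀ {n} → Graph n → Set
IsTree G = Connected G × Acyclic G

-- the rational a / b (b is always nonzero where used; a/0 := 0 by convention)
frac : ℕ → ℕ → ℚ
frac a zero    = 0ℚ
frac a (suc b) = (+ a) / suc b

-- The neighbourhoods of the ends of an edge ij of a tree are disjoint (a common
-- neighbour would close a triangle), so d_i + d_j ≤ n; together with d_j ≥ 1 and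
-- the excluded star case this gives d_j ≤ d_i ≤ n - 2 =: m.  Cross-multiplied, the
-- first inequality is m (a² + b²) ≤ ab (m² + 1), which is (ma - b)(mb - a) ≥ 0; the
-- second says that x / (x² + 1) strictly decreases for x ≥ 1.
module Submission where

open import Defs
open import Data.Nat using (ℕ; _+_; _*_; _∸_; _≥_; zero; suc; z≤n; s≤s; s≤s⁻¹; >-nonZero)
import Data.Nat as ℕ
open import Data.Nat.Properties
  using (≤-trans; ≤∧≢⇒<; m≤m+n; m≤n+m; m≤m*n; m≤n*m; *-mono-≤; +-mono-≤; +-comm; m+[n∸m]≡n; +-commutativeSemigroup)
open import Data.Nat.Tactic.RingSolver using (solve)
open import Algebra.Properties.CommutativeSemigroup +-commutativeSemigroup using () renaming (interchange to +-interchange)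
open import Data.Nat.ListAction using (sum)
open import Data.Fin using (Fin; zero; suc; inject₁)
open import Data.Bool using (true; false; if_then_else_)
open import Data.List using (List; []; _∷_; map; allFin; length)
open import Data.List.Properties using (length-tabulate)
open import Data.List.Relation.Unary.Any using (here; there)
open import Data.List.Membership.Propositional using (_∈_)
open import Data.List.Membership.Propositional.Properties using (∈-allFin)
open import Data.Integer using (+_)
import Data.Integer as ℤ
open import Data.Integer.Properties using (pos-*)
open import Data.Product using (_×_; _,_)
open import Data.Rational using (_≤_; _<_; toℚᵘ)
open import Data.Rational.Properties using (toℚᵘ-cancel-≤; toℚᵘ-cancel-<; toℚᵘ-fromℚᵘ)
open import Data.Rational.Unnormalised using (mkℚᵘ; _≃_; *≤*; *<*)
open import Data.Rational.Unnormalised.Properties using (≃-sym; ≤-respˡ-≃; ≤-respʳ-≃; <-respˡ-≃; <-respʳ-≃)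
open import Data.Empty using (⊥-elim)
open import Relation.Binary.PropositionalEquality using (_≡_; _≢_; refl; sym; trans; cong₂; subst; subst₂; module ≡-Reasoning)
open import Relation.Nullary using (¬_)

toℚᵘ-frac : ∀ a b → toℚᵘ (frac a (suc b)) ≃ mkℚᵘ (+ a) b
toℚᵘ-frac a b = toℚᵘ-fromℚᵘ (mkℚᵘ (+ a) b)

frac-≤ : ∀ {a b c d} → ℕ._<_ 0 b → ℕ._<_ 0 d → ℕ._≤_ (a * d) (c * b) → frac a b ≤ frac c d
frac-≤ {a} {suc b} {c} {suc d} _ _ ad≤cb =
  toℚᵘ-cancel-≤ (≤-respˡ-≃ (≃-sym (toℚᵘ-frac a b)) (≤-respʳ-≃ (≃-sym (toℚᵘ-frac c d))
    (*≤* (subst₂ ℤ._≤_ (pos-* a (suc d)) (pos-* c (suc b)) (ℤ.+≤+ ad≤cb)))))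

frac-< : ∀ {a b c d} → ℕ._<_ 0 b → ℕ._<_ 0 d → ℕ._<_ (a * d) (c * b) → frac a b < frac c d
frac-< {a} {suc b} {c} {suc d} _ _ ad<cb =
  toℚᵘ-cancel-< (<-respˡ-≃ (≃-sym (toℚᵘ-frac a b)) (<-respʳ-≃ (≃-sym (toℚᵘ-frac c d))
    (*<* (subst₂ ℤ._<_ (pos-* a (suc d)) (pos-* c (suc b)) (ℤ.+<+ ad<cb)))))

m*[a²+b²]+p*q≡a*b*[m²+1] : ∀ m a b p q → a + p ≡ m * b → b + q ≡ m * a →
  m * (a * a + b * b) + p * q ≡ a * b * (m * m + 1)
m*[a²+b²]+p*q≡a*b*[m²+1] m a b p q a+p≡mb b+q≡ma = begin
  m * (a * a + b * b) + p * q         ≡⟨ solve (m ∷ a ∷ b ∷ p ∷ q ∷ []) ⟩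
  a * (m * a) + b * (m * b) + p * q   ≡⟨ cong₂ (λ x y → a * x + b * y + p * q) (sym b+q≡ma) (sym a+p≡mb) ⟩
  a * (b + q) + b * (a + p) + p * q   ≡⟨ solve (a ∷ b ∷ p ∷ q ∷ []) ⟩
  (a + p) * (b + q) + a * b           ≡⟨ cong₂ (λ x y → x * y + a * b) a+p≡mb b+q≡ma ⟩
  m * b * (m * a) + a * b             ≡⟨ solve (m ∷ a ∷ b ∷ []) ⟩
  a * b * (m * m + 1)                 ∎
  where open ≡-Reasoning

m*[a²+b²]≤a*b*[m²+1] : ∀ m {a b} → ℕ._≤_ a (m * b) → ℕ._≤_ b (m * a) →
  ℕ._≤_ (m * (a * a + b * b)) (a * b * (m * m + 1))
m*[a²+b²]≤a*b*[m²+1] m {a} {b} a≤mb b≤ma =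
  subst (ℕ._≤_ _) (m*[a²+b²]+p*q≡a*b*[m²+1] m a b p q (m+[n∸m]≡n a≤mb) (m+[n∸m]≡n b≤ma))
    (m≤m+n _ (p * q))
  where
  p q : ℕ
  p = m * b ∸ a
  q = m * a ∸ b

[1+m]*[m²+1]<m*[[1+m]²+1] : ∀ {m} → ℕ._≤_ 1 m → ℕ._<_ (suc m * (m * m + 1)) (m * (suc m * suc m + 1))
[1+m]*[m²+1]<m*[[1+m]²+1] {suc k} _ = subst (ℕ._≤_ _) slack (m≤m+n _ (k * k + 3 * k))
  where
  slack : suc (suc (suc k) * (suc k * suc k + 1)) + (k * k + 3 * k) ≡ suc k * (suc (suc k) * suc (suc k) + 1)
  slack = solve (k ∷ [])

sum-map-+-≤-length : ∀ {A : Set} (f g : A → ℕ) (xs : List A) → (∀ x → ℕ._≤_ (f x + g x) 1) →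
  ℕ._≤_ (sum (map f xs) + sum (map g xs)) (length xs)
sum-map-+-≤-length f g [] _ = z≤n
sum-map-+-≤-length f g (x ∷ xs) f+g≤1 =
  subst (λ s → ℕ._≤_ s (suc (length xs))) (sym (+-interchange (f x) (sum (map f xs)) (g x) (sum (map g xs))))
    (+-mono-≤ (f+g≤1 x) (sum-map-+-≤-length f g xs f+g≤1))

∈⇒≤sum-map : ∀ {A : Set} (f : A → ℕ) {x} {xs : List A} → x ∈ xs → ℕ._≤_ (f x) (sum (map f xs))
∈⇒≤sum-map f {xs = y ∷ ys} (here refl) = m≤m+n (f y) _
∈⇒≤sum-map f {xs = y ∷ ys} (there x∈ys) = ≤-trans (∈⇒≤sum-map f x∈ys) (m≤n+m _ (f y))

module _ {n} (G : Graph n) where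

  Adj-sym : ∀ {u v} → Adj G u v → Adj G v u
  Adj-sym {u} {v} u~v = trans (symmetric G v u) u~v

  Adj-irrefl : ∀ {v} → ¬ Adj G v v
  Adj-irrefl {v} v~v with trans (sym v~v) (loopless G v)
  ... | ()

  Adj⇒≢ : ∀ {u v} → Adj G u v → u ≢ v
  Adj⇒≢ u~v refl = Adj-irrefl u~v

  triangle⇒cycle : ∀ {u v w} → Adj G u v → Adj G v w → Adj G w u → Cycle G
  triangle⇒cycle {u} {v} {w} u~v v~w w~u = record
    { k = 0 ; c = c ; distinct = distinct ; step = step ; close = w~u }
    where
    c : Fin 3 → Fin n
    c zero             = u
    c (suc zero)       = v
    c (suc (suc zero)) = w

    step : ∀ (x : Fin 2) → Adj G (c (inject₁ x)) (c (suc x))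
    step zero       = u~v
    step (suc zero) = v~w

    distinct : ∀ {x y} → c x ≡ c y → x ≡ y
    distinct {zero}             {zero}             _ = refl
    distinct {suc zero}         {suc zero}         _ = refl
    distinct {suc (suc zero)}   {suc (suc zero)}   _ = refl
    distinct {zero}             {suc zero}         e = ⊥-elim (Adj⇒≢ u~v e)
    distinct {suc zero}         {zero}             e = ⊥-elim (Adj⇒≢ u~v (sym e))
    distinct {suc zero}         {suc (suc zero)}   e = ⊥-elim (Adj⇒≢ v~w e)
    distinct {suc (suc zero)}   {suc zero}         e = ⊥-elim (Adj⇒≢ v~w (sym e))
    distinct {suc (suc zero)}   {zero}             e = ⊥-elim (Adj⇒≢ w~u e)
    distinct {zero}             {suc (suc zero)}   e = ⊥-elim (Adj⇒≢ w~u (sym e))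

  Adj⇒degree≥1 : ∀ {u v} → Adj G u v → ℕ._≤_ 1 (degree G u)
  Adj⇒degree≥1 {u} {v} u~v =
    subst (λ b → ℕ._≤_ (if b then 1 else 0) (degree G u)) u~v
      (∈⇒≤sum-map (λ w → if adj G u w then 1 else 0) (∈-allFin v))

  Acyclic⇒degree+degree≤n : Acyclic G → ∀ {i j} → Adj G i j → ℕ._≤_ (degree G i + degree G j) n
  Acyclic⇒degree+degree≤n acyclic {i} {j} i~j =
    subst (ℕ._≤_ _) (length-tabulate {n = n} (λ x → x))
      (sum-map-+-≤-length (λ u → if adj G i u then 1 else 0) (λ u → if adj G j u then 1 else 0)
        (allFin n) at-most-one)
    where
    at-most-one : ∀ u → ℕ._≤_ ((if adj G i u then 1 else 0) + (if adj G j u then 1 else 0)) 1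
    at-most-one u with adj G i u in i~u | adj G j u in j~u
    ... | true  | true  = ⊥-elim (acyclic (triangle⇒cycle i~j j~u (Adj-sym i~u)))
    ... | true  | false = s≤s z≤n
    ... | false | true  = s≤s z≤n
    ... | false | false = z≤n

a+b≤2+m⇒a≤m : ∀ {m a b} → ℕ._≤_ 1 b → ℕ._≤_ (a + b) (suc (suc m)) → ¬ (a ≡ suc m × b ≡ 1) → ℕ._≤_ a m
a+b≤2+m⇒a≤m {m} {a} {suc zero} _ a+1≤2+m a≢1+m =
  s≤s⁻¹ (≤∧≢⇒< (s≤s⁻¹ (subst (λ s → ℕ._≤_ s (suc (suc m))) (+-comm a 1) a+1≤2+m)) (λ e → a≢1+m (e , refl)))
a+b≤2+m⇒a≤m {m} {a} {suc (suc b)} _ a+2+b≤2+m _ =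
  ≤-trans (m≤n+m a b) (s≤s⁻¹ (s≤s⁻¹ (subst (λ s → ℕ._≤_ s (suc (suc m))) (+-comm a (suc (suc b))) a+2+b≤2+m)))

corollary2p3 : (n : ℕ) (T : Graph n) → IsTree T → (i j : Fin n) → Adj T i j →
    degree T i ≥ degree T j →
    ¬ (degree T i ≡ n ∸ 1 × degree T j ≡ 1) →
    (frac ((n ∸ 2)) ((n ∸ 2) * (n ∸ 2) + 1)
    ≤ frac (degree T i * degree T j) (degree T i * degree T i + degree T j * degree T j))
    × (frac (n ∸ 1) ((n ∸ 1) * (n ∸ 1) + 1) < frac (n ∸ 2) ((n ∸ 2) * (n ∸ 2) + 1))
corollary2p3 (suc zero) T _ zero zero i~i _ _ = ⊥-elim (Adj-irrefl T i~i)
corollary2p3 (suc (suc m)) T (_ , acyclic) i j i~j b≤a not-star =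
  frac-≤ {a = m} {c = a * b} (m≤n+m 1 (m * m)) (≤-trans (*-mono-≤ b≥1 b≥1) (m≤n+m (b * b) (a * a)))
    (m*[a²+b²]≤a*b*[m²+1] m a≤mb b≤ma) ,
  frac-< {a = suc m} {c = m} (m≤n+m 1 (suc m * suc m)) (m≤n+m 1 (m * m)) ([1+m]*[m²+1]<m*[[1+m]²+1] m≥1)
  where
  a b : ℕ
  a = degree T i
  b = degree T j
  b≥1 : ℕ._≤_ 1 b
  b≥1 = Adj⇒degree≥1 T (Adj-sym T i~j)
  a≤m : ℕ._≤_ a m
  a≤m = a+b≤2+m⇒a≤m b≥1 (Acyclic⇒degree+degree≤n T acyclic i~j) not-star
  m≥1 : ℕ._≤_ 1 m
  m≥1 = ≤-trans (≤-trans b≥1 b≤a) a≤m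
  a≤mb : ℕ._≤_ a (m * b)
  a≤mb = ≤-trans a≤m (m≤m*n m b {{>-nonZero b≥1}})
  b≤ma : ℕ._≤_ b (m * a)
  b≤ma = ≤-trans b≤a (m≤n*m a m {{>-nonZero m≥1}})
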